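{- For any tree $T$ of order $n\ge 2$, $2\, i(T)+1\le i_{dR}(T)\le 3\, i(T)$.
   Context: $i(T)$ is the independent domination number: the minimum cardinality of an independent dominating set. An independent double Roman dominating function (IDRDF) on a graph $G=(V,E)$ is a function $f:V\to\{0,1,2,3\}$ such that: every vertex $v$ with $f(v)=0$ has at least two neighbors $w$ with $f(w)=2$ or at least one neighbor $w$ with $f(w)=3$; every vertex $v$ with $f(v)=1$ has a neighbor $w$ with $f(w)\ge 2$; and $\{v: f(v)>0\}$ is independent. $i_{dR}(G)$ is the minimum weight $\sum_v f(v)$ of an IDRDF on $G$. -}

module Defs where

open import Data.Nat using (ℕ; zero; suc; _+_; _≤_; _<_; _≥_)
open import Data.Fin using (Fin)
open import Data.Fin.Subset using (Subset; _∈_; _∉_; ∣_∣)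
open import Data.List using (List; []; _∷_; map; allFin; length)
open import Data.Nat.ListAction using (sum)
open import Data.List.Relation.Unary.Unique.Propositional using (Unique)
open import Data.Product using (Σ; _×_; ∃; ∃-syntax)
open import Data.Sum using (_⊎_)
open import Relation.Nullary using (¬_; Dec)
open import Relation.Binary.PropositionalEquality using (_≡_)

record Graph (n : ℕ) : Set₁ where
  field
    Adj   : Fin n → Fin n → Set
    adj?  : ∀ u v → Dec (Adj u v)
    sym   : ∀ {u v} → Adj u v → Adj v u
    irrefl : ∀ {u} → ¬ Adj u u
open Graph public

module _ {n : ℕ} (G : Graph n) where

  data Walk : Fin n → Fin n → Set where
    here : ∀ {u} → Walk u u
    step : ∀ {u w v} → Adj G u w → Walk w v → Walk u v

  Connected : Set
  Connected = ∀ u v → Walk u v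

  PathFrom : Fin n → List (Fin n) → Fin n → Set
  PathFrom x [] y = x ≡ y
  PathFrom x (z ∷ zs) y = Adj G x z × PathFrom z zs y

  -- A cycle: distinct vertices x, v₁, …, v_k (k ≥ 2, so at least 3 vertices),
  -- x ~ v₁ ~ … ~ v_k consecutive adjacencies, y = v_k, and y ~ x closing it.
  Cycle : Set
  Cycle = Σ (Fin n) λ x → Σ (List (Fin n)) λ zs → Σ (Fin n) λ y →
            Unique (x ∷ zs) × (2 ≤ length zs) × PathFrom x zs y × Adj G y x

  Acyclic : Set
  Acyclic = ¬ Cycle

  IsTree : Set
  IsTree = Connected × Acyclic

  Independent : Subset n → Set
  Independent S = ∀ u v → u ∈ S → v ∈ S → ¬ Adj G u v

  Dominating : Subset n → Set
  Dominating S = ∀ v → v ∉ S → ∃[ u ] (u ∈ S × Adj G u v)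

  IndependentDominating : Subset n → Set
  IndependentDominating S = Independent S × Dominating S

  IsIndepDominationNumber : ℕ → Set
  IsIndepDominationNumber k =
    (∃[ S ] (IndependentDominating S × ∣ S ∣ ≡ k)) ×
    (∀ S → IndependentDominating S → k ≤ ∣ S ∣)

  IsIDRDF : (Fin n → ℕ) → Set
  IsIDRDF f =
    (∀ v → f v ≤ 3) ×
    (∀ v → f v ≡ 0 →
       (∃[ w ] (Adj G v w × f w ≡ 3)) ⊎
       (∃[ w₁ ] ∃[ w₂ ] (¬ w₁ ≡ w₂ × Adj G v w₁ × Adj G v w₂ × f w₁ ≡ 2 × f w₂ ≡ 2))) ×
    (∀ v → f v ≡ 1 → ∃[ w ] (Adj G v w × 2 ≤ f w)) ×
    (∀ u v → 0 < f u → 0 < f v → ¬ Adj G u v)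

  weight : (Fin n → ℕ) → ℕ
  weight f = sum (map f (allFin n))

  IsIndepDoubleRomanNumber : ℕ → Set
  IsIndepDoubleRomanNumber k =
    (∃[ f ] (IsIDRDF f × weight f ≡ k)) ×
    (∀ f → IsIDRDF f → k ≤ weight f)

module Submission where

-- Upper bound.  Tripling the indicator of an independent dominating set S
-- gives an IDRDF of weight 3|S|.
--
-- An IDRDF f never takes the value 1 (such a vertex would need
-- a positive neighbour), so its support P = {f > 0} is an independent
-- dominating set of vertices of weight at least 2: w(f) ≥ 2|P| ≥ 2i.  If some
-- vertex has value 3 this improves to w(f) ≥ 2|P| + 1.  Otherwise every
-- vertex of value 0 has two neighbours of value 2.  Take such a vertex v (an
-- endpoint of any edge) and the exchange set E = (P ∖ N(v)) ∪ {v}.  If the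
-- graph has no 4-cycle, E is again independent dominating, and as v has two
-- neighbours in P, |E| + 1 ≤ |P|; hence w(f) ≥ 2|P| ≥ 2i + 2.  So the lower
-- bound holds for every graph with an edge and no 4-cycle, and trees of
-- order at least 2 are such graphs.

open import Defs
open import Data.Nat using (ℕ; zero; suc; _+_; _*_; _≤_; _≥_; _<_; z≤n; s≤s; s≤s⁻¹; _<?_; _≟_)
open import Data.Nat.Properties
  using (≤-refl; ≤-reflexive; ≤-trans; n≤1+n; +-suc; +-identityʳ; +-comm;
         +-mono-≤; +-monoʳ-≤; +-monoˡ-≤; *-monoʳ-≤; *-distribˡ-+; *-zeroʳ; n≤0⇒n≡0; ≮⇒≥; +-0-monoid; +-commutativeSemigroup;
         module ≤-Reasoning)
open import Algebra.Properties.CommutativeSemigroup +-commutativeSemigroup using (interchange)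
open import Algebra.Properties.Monoid.Sum +-0-monoid using () renaming (sum to ∑)
open import Data.Bool using (true; false; if_then_else_)
open import Data.Fin using (Fin; zero; suc)
open import Data.Fin.Properties using (any?)
open import Data.Fin.Subset using (Subset; _∈_; _∉_; _⊆_; _⊂_; _∪_; ⁅_⁆; ∣_∣)
open import Data.Fin.Subset.Properties
  using (_∈?_; x∈⁅x⁆; x∈⁅y⁆⇒x≡y; ∣⁅x⁆∣≡1; p⊂q⇒∣p∣<∣q∣; p⊆p∪q; x∈p∪q⁺; x∈p∪q⁻)
open import Data.Vec as Vec using ([]; _∷_; lookup)
open import Data.Vec.Properties using (lookup∘tabulate; []=⇒lookup; lookup⇒[]=)
open import Data.List using ([]; _∷_; tabulate)
open import Data.List.Properties using (map-tabulate)
open import Data.Nat.ListAction using (sum)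
open import Data.List.Relation.Unary.All using ([]; _∷_)
open import Data.List.Relation.Unary.AllPairs using ([]; _∷_)
open import Data.List.Relation.Unary.Unique.Propositional using (Unique)
open import Data.Product using (_×_; _,_; ∃; ∃₂; ∃-syntax; proj₁; proj₂)
open import Data.Empty using (⊥; ⊥-elim)
open import Data.Sum using (_⊎_; inj₁; inj₂)
open import Function using (_∘_)
open import Relation.Nullary using (yes; no; does; ¬_; ¬?; _×-dec_; _⊎-dec_; contradiction)
open import Relation.Nullary.Decidable using (dec-true)
open import Relation.Unary using (Pred; Decidable)
open import Relation.Binary.PropositionalEquality
  using (_≡_; _≢_; refl; trans; cong; cong₂; subst)
import Relation.Binary.PropositionalEquality as ≡
import Data.Fin as Fin

sum-tabulate : ∀ {n} (g : Fin n → ℕ) → sum (tabulate g) ≡ ∑ g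
sum-tabulate {zero}  g = refl
sum-tabulate {suc n} g = cong (g zero +_) (sum-tabulate (g ∘ suc))

weight≡∑ : ∀ {n} (G : Graph n) (g : Fin n → ℕ) → weight G g ≡ ∑ g
weight≡∑ G g = trans (cong sum (map-tabulate (λ u → u) g)) (sum-tabulate g)

∑-mono : ∀ {n} {g h : Fin n → ℕ} → (∀ u → g u ≤ h u) → ∑ g ≤ ∑ h
∑-mono {zero}  g≤h = z≤n
∑-mono {suc n} g≤h = +-mono-≤ (g≤h zero) (∑-mono (g≤h ∘ suc))

∑-+ : ∀ {n} (g h : Fin n → ℕ) → ∑ (λ u → g u + h u) ≡ ∑ g + ∑ h
∑-+ {zero}  g h = refl
∑-+ {suc n} g h =
  trans (cong (g zero + h zero +_) (∑-+ (g ∘ suc) (h ∘ suc)))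
        (interchange (g zero) (h zero) (∑ (g ∘ suc)) (∑ (h ∘ suc)))

∑-scale : ∀ {n} (c : ℕ) (g : Fin n → ℕ) → ∑ (λ u → c * g u) ≡ c * ∑ g
∑-scale {zero}  c g = ≡.sym (*-zeroʳ c)
∑-scale {suc n} c g =
  trans (cong (c * g zero +_) (∑-scale c (g ∘ suc)))
        (≡.sym (*-distribˡ-+ c (g zero) (∑ (g ∘ suc))))

χ : ∀ {n} → Subset n → Fin n → ℕ
χ S u = if lookup S u then 1 else 0

∑-χ : ∀ {n} (S : Subset n) → ∑ (χ S) ≡ ∣ S ∣
∑-χ []          = refl
∑-χ (true ∷ S)  = cong suc (∑-χ S)
∑-χ (false ∷ S) = ∑-χ S

χ-∈ : ∀ {n} {S : Subset n} {u} → u ∈ S → χ S u ≡ 1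
χ-∈ u∈S = cong (λ b → if b then 1 else 0) ([]=⇒lookup u∈S)

χ-∉ : ∀ {n} {S : Subset n} {u} → u ∉ S → χ S u ≡ 0
χ-∉ {S = S} {u} u∉S with lookup S u in eq
... | true  = contradiction (lookup⇒[]= u S eq) u∉S
... | false = refl

∑-scaled-χ : ∀ {n} (c : ℕ) (S : Subset n) → ∑ (λ u → c * χ S u) ≡ c * ∣ S ∣
∑-scaled-χ c S = trans (∑-scale c (χ S)) (cong (c *_) (∑-χ S))

∣p∪q∣≤∣p∣+∣q∣ : ∀ {n} (p q : Subset n) → ∣ p ∪ q ∣ ≤ ∣ p ∣ + ∣ q ∣
∣p∪q∣≤∣p∣+∣q∣ []          []          = z≤n
∣p∪q∣≤∣p∣+∣q∣ (true ∷ p)  (true ∷ q)  =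
  s≤s (≤-trans (∣p∪q∣≤∣p∣+∣q∣ p q) (+-monoʳ-≤ ∣ p ∣ (n≤1+n ∣ q ∣)))
∣p∪q∣≤∣p∣+∣q∣ (true ∷ p)  (false ∷ q) = s≤s (∣p∪q∣≤∣p∣+∣q∣ p q)
∣p∪q∣≤∣p∣+∣q∣ (false ∷ p) (true ∷ q)  =
  ≤-trans (s≤s (∣p∪q∣≤∣p∣+∣q∣ p q)) (≤-reflexive (≡.sym (+-suc ∣ p ∣ ∣ q ∣)))
∣p∪q∣≤∣p∣+∣q∣ (false ∷ p) (false ∷ q) = ∣p∪q∣≤∣p∣+∣q∣ p q

-- Two distinct elements of Q outside S ⊆ Q make Q at least two larger:
-- S ⊂ S ∪ {a} ⊂ Q.
two-outside : ∀ {n} {S Q : Subset n} {a b} → S ⊆ Q → a ∈ Q → b ∈ Q →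
              a ∉ S → b ∉ S → a ≢ b → 2 + ∣ S ∣ ≤ ∣ Q ∣
two-outside {S = S} {Q} {a} {b} S⊆Q a∈Q b∈Q a∉S b∉S a≢b =
  ≤-trans (s≤s (p⊂q⇒∣p∣<∣q∣ S⊂S+a)) (p⊂q⇒∣p∣<∣q∣ S+a⊂Q)
  where
  S⊂S+a : S ⊂ S ∪ ⁅ a ⁆
  S⊂S+a = p⊆p∪q ⁅ a ⁆ , a , x∈p∪q⁺ (inj₂ (x∈⁅x⁆ a)) , a∉S

  S+a⊆Q : S ∪ ⁅ a ⁆ ⊆ Q
  S+a⊆Q u∈ with x∈p∪q⁻ S ⁅ a ⁆ u∈
  ... | inj₁ u∈S  = S⊆Q u∈S
  ... | inj₂ u∈⁅a⁆ = subst (_∈ Q) (≡.sym (x∈⁅y⁆⇒x≡y a u∈⁅a⁆)) a∈Q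

  b∉S+a : b ∉ S ∪ ⁅ a ⁆
  b∉S+a b∈ with x∈p∪q⁻ S ⁅ a ⁆ b∈
  ... | inj₁ b∈S  = b∉S b∈S
  ... | inj₂ b∈⁅a⁆ = a≢b (≡.sym (x∈⁅y⁆⇒x≡y a b∈⁅a⁆))

  S+a⊂Q : S ∪ ⁅ a ⁆ ⊂ Q
  S+a⊂Q = S+a⊆Q , b , b∈Q , b∉S+a

⟦_⟧ : ∀ {n ℓ} {Q : Pred (Fin n) ℓ} → Decidable Q → Subset n
⟦ Q? ⟧ = Vec.tabulate (λ u → does (Q? u))

∈⟦⟧⁺ : ∀ {n ℓ} {Q : Pred (Fin n) ℓ} (Q? : Decidable Q) {u} → Q u → u ∈ ⟦ Q? ⟧
∈⟦⟧⁺ Q? {u} q = lookup⇒[]= u ⟦ Q? ⟧ (trans (lookup∘tabulate _ u) (dec-true (Q? u) q))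

∈⟦⟧⁻ : ∀ {n ℓ} {Q : Pred (Fin n) ℓ} (Q? : Decidable Q) {u} → u ∈ ⟦ Q? ⟧ → Q u
∈⟦⟧⁻ Q? {u} u∈ with Q? u | trans (≡.sym (lookup∘tabulate (λ u → does (Q? u)) u)) ([]=⇒lookup u∈)
... | yes q | _ = q
... | no _  | ()

adj⇒≢ : ∀ {n} (G : Graph n) {u v} → Adj G u v → u ≢ v
adj⇒≢ G uv refl = irrefl G uv

FourCycleFree : ∀ {n} → Graph n → Set
FourCycleFree G = ∀ {u a v b} → Adj G u a → Adj G a v → Adj G v b → Adj G b u →
                  a ≢ b → u ≢ v → ⊥

acyclic⇒four-cycle-free : ∀ {n} (G : Graph n) → Acyclic G → FourCycleFree G
acyclic⇒four-cycle-free G acyclic {u} {a} {v} {b} ua av vb bu a≢b u≢v =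
  acyclic (u , a ∷ v ∷ b ∷ [] , b , distinct , s≤s (s≤s z≤n) , (ua , av , vb , refl) , bu)
  where
  distinct : Unique (u ∷ a ∷ v ∷ b ∷ [])
  distinct = (adj⇒≢ G ua ∷ u≢v ∷ adj⇒≢ G (Graph.sym G bu) ∷ [])
           ∷ (adj⇒≢ G av ∷ a≢b ∷ [])
           ∷ (adj⇒≢ G vb ∷ [])
           ∷ []
           ∷ []

connected⇒edge : ∀ {n} (G : Graph n) → n ≥ 2 → Connected G → ∃₂ (Adj G)
connected⇒edge G (s≤s (s≤s _)) connected with connected zero (suc zero)
... | step uw _ = _ , _ , uw

module Tripling {n} (G : Graph n) {S : Subset n} (S-ids : IndependentDominating G S) where

  tripled : Fin n → ℕ
  tripled u = 3 * χ S u

  tripled-values : ∀ u → (u ∈ S × tripled u ≡ 3) ⊎ (u ∉ S × tripled u ≡ 0)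
  tripled-values u with u ∈? S
  ... | yes u∈S = inj₁ (u∈S , cong (3 *_) (χ-∈ u∈S))
  ... | no  u∉S = inj₂ (u∉S , cong (3 *_) (χ-∉ u∉S))

  tripled-IDRDF : IsIDRDF G tripled
  tripled-IDRDF = at-most-3 , zero-dominated , no-one , positive-independent
    where
    at-most-3 : ∀ u → tripled u ≤ 3
    at-most-3 u with tripled-values u
    ... | inj₁ (_ , t≡3) = ≤-reflexive t≡3
    ... | inj₂ (_ , t≡0) = subst (_≤ 3) (≡.sym t≡0) z≤n

    zero-dominated : ∀ u → tripled u ≡ 0 →
      (∃[ w ] (Adj G u w × tripled w ≡ 3)) ⊎
      (∃[ w₁ ] ∃[ w₂ ] (w₁ ≢ w₂ × Adj G u w₁ × Adj G u w₂ × tripled w₁ ≡ 2 × tripled w₂ ≡ 2))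
    zero-dominated u t≡0 with tripled-values u
    ... | inj₁ (_ , t≡3) = contradiction (trans (≡.sym t≡3) t≡0) (λ ())
    ... | inj₂ (u∉S , _) with proj₂ S-ids u u∉S
    ...   | w , w∈S , wu = inj₁ (w , Graph.sym G wu , cong (3 *_) (χ-∈ w∈S))

    no-one : ∀ u → tripled u ≡ 1 → ∃[ w ] (Adj G u w × 2 ≤ tripled w)
    no-one u t≡1 with tripled-values u
    ... | inj₁ (_ , t≡3) = contradiction (trans (≡.sym t≡3) t≡1) (λ ())
    ... | inj₂ (_ , t≡0) = contradiction (trans (≡.sym t≡0) t≡1) (λ ())

    positive⇒∈ : ∀ u → 0 < tripled u → u ∈ S
    positive⇒∈ u 0<t with tripled-values u
    ... | inj₁ (u∈S , _) = u∈S
    ... | inj₂ (_ , t≡0) = contradiction (subst (0 <_) t≡0 0<t) (λ ())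

    positive-independent : ∀ u v → 0 < tripled u → 0 < tripled v → ¬ Adj G u v
    positive-independent u v 0<u 0<v = proj₁ S-ids u v (positive⇒∈ u 0<u) (positive⇒∈ v 0<v)

  weight-tripled : weight G tripled ≡ 3 * ∣ S ∣
  weight-tripled = trans (weight≡∑ G tripled) (∑-scaled-χ 3 S)

module IDRDF {n} (G : Graph n) {f : Fin n → ℕ} (f-IDRDF : IsIDRDF G f) where

  zero-dominated : ∀ v → f v ≡ 0 →
    (∃[ w ] (Adj G v w × f w ≡ 3)) ⊎
    (∃[ w₁ ] ∃[ w₂ ] (w₁ ≢ w₂ × Adj G v w₁ × Adj G v w₂ × f w₁ ≡ 2 × f w₂ ≡ 2))
  zero-dominated = proj₁ (proj₂ f-IDRDF)

  one-dominated : ∀ v → f v ≡ 1 → ∃[ w ] (Adj G v w × 2 ≤ f w)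
  one-dominated = proj₁ (proj₂ (proj₂ f-IDRDF))

  positive-independent : ∀ u v → 0 < f u → 0 < f v → ¬ Adj G u v
  positive-independent = proj₂ (proj₂ (proj₂ f-IDRDF))

  positive : ∀ {u k} → f u ≡ suc k → 0 < f u
  positive fu≡1+k = subst (0 <_) (≡.sym fu≡1+k) (s≤s z≤n)

  positive? : Decidable (λ u → 0 < f u)
  positive? u = 0 <? f u

  non-positive : ∀ {u} → ¬ 0 < f u → f u ≡ 0
  non-positive = n≤0⇒n≡0 ∘ ≮⇒≥

  -- A vertex of value 1 would have an adjacent positive vertex.
  no-one : ∀ u → f u ≢ 1
  no-one u fu≡1 with one-dominated u fu≡1
  ... | w , uw , 2≤fw = positive-independent u w (positive fu≡1) (≤-trans (s≤s z≤n) 2≤fw) uw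

  positive⇒≥2 : ∀ u → 0 < f u → 2 ≤ f u
  positive⇒≥2 u 0<fu with f u | no-one u
  ... | suc zero    | fu≢1 = contradiction refl fu≢1
  ... | suc (suc _) | _    = s≤s (s≤s z≤n)

  zero-vertex : ∃₂ (Adj G) → ∃ λ v → f v ≡ 0
  zero-vertex (u , v , uv) with positive? u | positive? v
  ... | no  0≮fu | _        = u , non-positive 0≮fu
  ... | yes _    | no  0≮fv = v , non-positive 0≮fv
  ... | yes 0<fu | yes 0<fv = contradiction uv (positive-independent u v 0<fu 0<fv)

  support : Subset n
  support = ⟦ positive? ⟧

  support-IDS : IndependentDominating G support
  support-IDS = independent , dominating
    where
    independent : Independent G support
    independent u v u∈P v∈P = positive-independent u v (∈⟦⟧⁻ positive? u∈P) (∈⟦⟧⁻ positive? v∈P)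

    dominating : Dominating G support
    dominating v v∉P with zero-dominated v (non-positive (v∉P ∘ ∈⟦⟧⁺ positive?))
    ... | inj₁ (w , vw , fw≡3)                 = w , ∈⟦⟧⁺ positive? (positive fw≡3) , Graph.sym G vw
    ... | inj₂ (w , _ , _ , vw , _ , fw≡2 , _) = w , ∈⟦⟧⁺ positive? (positive fw≡2) , Graph.sym G vw

  doubled-support≤f : ∀ u → 2 * χ support u ≤ f u
  doubled-support≤f u with u ∈? support
  ... | yes u∈P = subst (_≤ f u) (cong (2 *_) (≡.sym (χ-∈ u∈P))) (positive⇒≥2 u (∈⟦⟧⁻ positive? u∈P))
  ... | no  u∉P = subst (_≤ f u) (cong (2 *_) (≡.sym (χ-∉ u∉P))) z≤n

  weight-support : 2 * ∣ support ∣ ≤ ∑ f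
  weight-support = subst (_≤ ∑ f) (∑-scaled-χ 2 support) (∑-mono doubled-support≤f)

  weight-support-with-three : ∀ {x} → f x ≡ 3 → 2 * ∣ support ∣ + 1 ≤ ∑ f
  weight-support-with-three {x} fx≡3 = begin
    2 * ∣ support ∣ + 1
      ≡⟨ ≡.sym (cong₂ _+_ (∑-scaled-χ 2 support) (trans (∑-χ ⁅ x ⁆) (∣⁅x⁆∣≡1 x))) ⟩
    ∑ (λ u → 2 * χ support u) + ∑ (χ ⁅ x ⁆)
      ≡⟨ ≡.sym (∑-+ (λ u → 2 * χ support u) (χ ⁅ x ⁆)) ⟩
    ∑ (λ u → 2 * χ support u + χ ⁅ x ⁆ u)
      ≤⟨ ∑-mono pointwise ⟩
    ∑ f ∎
    where
    open ≤-Reasoning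
    pointwise : ∀ u → 2 * χ support u + χ ⁅ x ⁆ u ≤ f u
    pointwise u with u Fin.≟ x
    ... | yes refl rewrite χ-∈ (∈⟦⟧⁺ positive? (positive fx≡3)) | χ-∈ (x∈⁅x⁆ x) | fx≡3 = ≤-refl
    ... | no  u≢x  rewrite χ-∉ (u≢x ∘ x∈⁅y⁆⇒x≡y x) | +-identityʳ (2 * χ support u) = doubled-support≤f u

  module Exchange (four-cycle-free : FourCycleFree G) (no-three : ∀ u → f u ≢ 3)
                  {v} (fv≡0 : f v ≡ 0) where

    heavy-pair : ∀ {u} → f u ≡ 0 →
      ∃[ w₁ ] ∃[ w₂ ] (w₁ ≢ w₂ × Adj G u w₁ × Adj G u w₂ × f w₁ ≡ 2 × f w₂ ≡ 2)
    heavy-pair {u} fu≡0 with zero-dominated u fu≡0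
    ... | inj₁ (w , _ , fw≡3) = contradiction fw≡3 (no-three w)
    ... | inj₂ pair           = pair

    in-exchange? : Decidable (λ u → (0 < f u × ¬ Adj G v u) ⊎ u ≡ v)
    in-exchange? u = (positive? u ×-dec ¬? (adj? G v u)) ⊎-dec (u Fin.≟ v)

    exchange : Subset n
    exchange = ⟦ in-exchange? ⟧

    v∈E : v ∈ exchange
    v∈E = ∈⟦⟧⁺ in-exchange? (inj₂ refl)

    positive-non-neighbour∈E : ∀ {u} → 0 < f u → ¬ Adj G v u → u ∈ exchange
    positive-non-neighbour∈E 0<fu ¬vu = ∈⟦⟧⁺ in-exchange? (inj₁ (0<fu , ¬vu))

    neighbour∉E : ∀ {u} → Adj G v u → u ∉ exchange
    neighbour∉E vu u∈E with ∈⟦⟧⁻ in-exchange? u∈E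
    ... | inj₁ (_ , ¬vu) = ¬vu vu
    ... | inj₂ refl      = irrefl G vu

    exchange-IDS : IndependentDominating G exchange
    exchange-IDS = independent , dominating
      where
      independent : Independent G exchange
      independent x y x∈E y∈E with ∈⟦⟧⁻ in-exchange? x∈E | ∈⟦⟧⁻ in-exchange? y∈E
      ... | inj₁ (0<fx , _)   | inj₁ (0<fy , _)   = positive-independent x y 0<fx 0<fy
      ... | inj₁ (_ , ¬vx)    | inj₂ refl         = ¬vx ∘ Graph.sym G
      ... | inj₂ refl         | inj₁ (_ , ¬vy)    = ¬vy
      ... | inj₂ refl         | inj₂ refl         = irrefl G

      -- A positive vertex outside E is a neighbour of v; a zero vertex u
      -- outside E has a 2-neighbour outside N(v), else v and u would share
      -- two common neighbours.
      dominating : Dominating G exchange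
      dominating u u∉E with positive? u | adj? G v u
      ... | _        | yes vu  = v , v∈E , vu
      ... | yes 0<fu | no  ¬vu = contradiction (positive-non-neighbour∈E 0<fu ¬vu) u∉E
      ... | no  0≮fu | no  _   with heavy-pair (non-positive 0≮fu)
      ...   | w₁ , w₂ , w₁≢w₂ , uw₁ , uw₂ , fw₁≡2 , fw₂≡2 with adj? G v w₁ | adj? G v w₂
      ...     | no ¬vw₁ | _       = w₁ , positive-non-neighbour∈E (positive fw₁≡2) ¬vw₁ , Graph.sym G uw₁
      ...     | yes _   | no ¬vw₂ = w₂ , positive-non-neighbour∈E (positive fw₂≡2) ¬vw₂ , Graph.sym G uw₂
      ...     | yes vw₁ | yes vw₂ = ⊥-elim
          (four-cycle-free vw₁ (Graph.sym G uw₁) uw₂ (Graph.sym G vw₂) w₁≢w₂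
                           (λ v≡u → u∉E (subst (_∈ exchange) v≡u v∈E)))

    -- E ⊆ {v} ∪ P while the two 2-neighbours of v lie in P ∖ E.
    exchange-smaller : suc ∣ exchange ∣ ≤ ∣ support ∣
    exchange-smaller with heavy-pair fv≡0
    ... | w₁ , w₂ , w₁≢w₂ , vw₁ , vw₂ , fw₁≡2 , fw₂≡2 = s≤s⁻¹ (begin
      2 + ∣ exchange ∣
        ≤⟨ two-outside E⊆v+P (in-P fw₁≡2) (in-P fw₂≡2) (neighbour∉E vw₁) (neighbour∉E vw₂) w₁≢w₂ ⟩
      ∣ ⁅ v ⁆ ∪ support ∣
        ≤⟨ ∣p∪q∣≤∣p∣+∣q∣ ⁅ v ⁆ support ⟩
      ∣ ⁅ v ⁆ ∣ + ∣ support ∣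
        ≡⟨ cong (_+ ∣ support ∣) (∣⁅x⁆∣≡1 v) ⟩
      suc ∣ support ∣ ∎)
      where
      open ≤-Reasoning
      in-P : ∀ {w} → f w ≡ 2 → w ∈ ⁅ v ⁆ ∪ support
      in-P fw≡2 = x∈p∪q⁺ (inj₂ (∈⟦⟧⁺ positive? (positive fw≡2)))

      E⊆v+P : exchange ⊆ ⁅ v ⁆ ∪ support
      E⊆v+P u∈E with ∈⟦⟧⁻ in-exchange? u∈E
      ... | inj₁ (0<fu , _) = x∈p∪q⁺ (inj₂ (∈⟦⟧⁺ positive? 0<fu))
      ... | inj₂ refl       = x∈p∪q⁺ (inj₁ (x∈⁅x⁆ v))

lower-bound : ∀ {n} (G : Graph n) → FourCycleFree G → ∃₂ (Adj G) →
              ∀ {i} → (∀ S → IndependentDominating G S → i ≤ ∣ S ∣) →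
              ∀ {f} → IsIDRDF G f → 2 * i + 1 ≤ ∑ f
lower-bound G four-cycle-free edge {i} i-min {f} f-IDRDF with any? (λ x → f x ≟ 3)
... | yes (x , fx≡3) = begin
  2 * i + 1           ≤⟨ +-monoˡ-≤ 1 (*-monoʳ-≤ 2 (i-min support support-IDS)) ⟩
  2 * ∣ support ∣ + 1 ≤⟨ weight-support-with-three fx≡3 ⟩
  ∑ f                 ∎
  where open IDRDF G f-IDRDF
        open ≤-Reasoning
... | no no-three = begin
  2 * i + 1       ≡⟨ +-comm (2 * i) 1 ⟩
  1 + 2 * i       ≤⟨ n≤1+n (1 + 2 * i) ⟩
  2 + 2 * i       ≡⟨ ≡.sym (*-distribˡ-+ 2 1 i) ⟩
  2 * suc i       ≤⟨ *-monoʳ-≤ 2 (≤-trans (s≤s (i-min exchange exchange-IDS)) exchange-smaller) ⟩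
  2 * ∣ support ∣ ≤⟨ weight-support ⟩
  ∑ f             ∎
  where open IDRDF G f-IDRDF
        open Exchange four-cycle-free (λ u fu≡3 → no-three (u , fu≡3)) (proj₂ (zero-vertex edge))
        open ≤-Reasoning

corollary19 : (n : ℕ) → n ≥ 2 → (T : Graph n) → IsTree T →
              (i idR : ℕ) → IsIndepDominationNumber T i → IsIndepDoubleRomanNumber T idR →
              (2 * i + 1 ≤ idR) × (idR ≤ 3 * i)
corollary19 n n≥2 T (connected , acyclic) i idR
            ((S , S-IDS , ∣S∣≡i) , i-min) ((f , f-IDRDF , wf≡idR) , idR-min) =
    subst (2 * i + 1 ≤_) (trans (≡.sym (weight≡∑ T f)) wf≡idR)
      (lower-bound T (acyclic⇒four-cycle-free T acyclic) (connected⇒edge T n≥2 connected)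
                   i-min f-IDRDF)
  , (begin
      idR              ≤⟨ idR-min tripled tripled-IDRDF ⟩
      weight T tripled ≡⟨ weight-tripled ⟩
      3 * ∣ S ∣        ≡⟨ cong (3 *_) ∣S∣≡i ⟩
      3 * i            ∎)
  where open Tripling T S-IDS
        open ≤-Reasoning
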